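{- For every finite set $S=S_C\cup S_f$, where $S_C$ is a finite set of equations between constants of a finite set $C$ and $S_f$ is a finite set of equations between $f$-monomials over $C$ ($f$ an AC symbol), and every total admissible ordering $\gg_f$ on $f$-monomials extending a total ordering $\gg$ on $C$, the algorithm SingleACCompletion$(S,\gg_f)$ terminates; that is, rules cannot be added to $R_f$ infinitely often.
   Context: $f$-monomials: for an AC symbol $f$ and finite set $C$ of constants, $f(M)$ with $M$ a nonempty finite multiset over $C$; a constant $c$ is identified with $f(\{\!\{c\}\!\})$. On multisets $\cup$ is multiset sum, $\cap$ multiset intersection (min of multiplicities), $-$ truncated multiset difference, $\subseteq$ sub-multiset. A rule $f(A)\rightarrow f(B)$ rewrites $f(M)$ to $f((M-A)\cup B)$ when $A\subseteq M$. An ordering $\gg_f$ on $f$-monomials is admissible if it is a total well-founded ordering extending a total ordering $\gg$ on $C$ such that (i) $f(A)\gg_f f(B)$ whenever $B$ is a proper sub-multiset of $A$, and (ii) $f(A_1)\gg_f f(A_2)$ implies $f(A_1\cup B)\gg_f f(A_2\cup B)$ for every multiset $B$. For distinct rules $f(A_1)\rightarrow f(A_2)$, $f(B_1)\rightarrow f(B_2)$ with $AB=(A_1\cup B_1)-(A_1\cap B_1)$, their critical pair is $(f((AB-A_1)\cup A_2), f((AB-B_1)\cup B_2))$. Algorithm SingleACCompletion$(S_f\cup S_C,\gg_f)$: (1) For each constant $c$, let $\hat c$ be the $\gg$-least constant in the equivalence class of $c$ generated by $S_C$; let $R_C=\{c\rightarrow\hat c\mid c\neq \hat c\}$; set $R_f:=R_C$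 and $T:=S_f$. (2) Pick and remove an equation $l=r$ from $T$; compute normal forms $\hat l,\hat r$ with respect to $R_f$; if they are equal discard the equation, otherwise orient it with $\gg_f$ into a rule, say $\hat l\rightarrow\hat r$ with $\hat l\gg_f\hat r$. (3) Add to $T$ the critical pairs (as equations) between $\hat l\rightarrow\hat r$ and every rule of $R_f$. (4) Add $\hat l\rightarrow\hat r$ to $R_f$ and interreduce: for every other rule $l\rightarrow r$ of $R_f$, if $l$ is reducible by the new rule, remove $l\rightarrow r$ from $R_f$ and insert $l=r$ into $T$; else if $r$ is reducible by the new rule, replace $r$ by a normal form $r'$ of (the reduct of) $r$, i.e. replace the rule by $l\rightarrow r'$. (5) Repeat steps (2)–(4) until $T$ is empty and the critical pairs among all pairs of rules in $R_f$ are joinable. (6) Output $R_f$. -}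

module Defs where

open import Data.Nat using (ℕ; zero; suc; _+_; _∸_; _⊓_; _≤_; _<_)
open import Data.Fin using (Fin; _≟_)
open import Data.Vec using (Vec; zipWith; lookup; tabulate)
open import Data.Vec.Relation.Binary.Pointwise.Inductive using (Pointwise)
open import Data.List using (List; []; _∷_; _++_; map; filter; allFin)
open import Data.List.Membership.Propositional using (_∈_)
open import Data.Product using (Σ; ∃; ∃-syntax; _×_; _,_; proj₁; proj₂)
open import Data.Sum using (_⊎_)
open import Relation.Binary.PropositionalEquality using (_≡_; _≢_)
open import Relation.Nullary using (¬_; ¬?; yes; no)
open import Relation.Binary using (Rel; IsStrictTotalOrder)
open import Relation.Binary.Construct.Closure.ReflexiveTransitive using (Star)
open import Relation.Binary.Construct.Closure.Equivalence using (EqClosure)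
open import Induction.WellFounded using (Acc)

-- Multisets over the finite set of constants C = Fin n,
-- represented by their multiplicity vectors.
-- An f-monomial f(M) is identified with the nonempty multiset M.

Mset : ℕ → Set
Mset n = Vec ℕ n

module _ {n : ℕ} where

  _∪_ : Mset n → Mset n → Mset n
  _∪_ = zipWith _+_

  _∩_ : Mset n → Mset n → Mset n
  _∩_ = zipWith _⊓_

  _−_ : Mset n → Mset n → Mset n
  _−_ = zipWith _∸_

  _⊆_ : Mset n → Mset n → Set
  _⊆_ = Pointwise _≤_

  NonEmpty : Mset n → Set
  NonEmpty M = ∃[ i ] (0 < lookup M i)

  -- the constant c, identified with f({{c}})
  const : Fin n → Mset n
  const c = tabulate (λ j → isC j)
    where
    isC : Fin n → ℕ
    isC j with j ≟ c
    ... | yes _ = 1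
    ... | no _ = 0

record Admissible {n : ℕ} (_≻_ : Rel (Fin n) _) (_≻f_ : Rel (Mset n) _) : Set where
  field
    irrefl   : ∀ M → NonEmpty M → ¬ (M ≻f M)
    trans    : ∀ M N P → NonEmpty M → NonEmpty N → NonEmpty P →
               M ≻f N → N ≻f P → M ≻f P
    total    : ∀ M N → NonEmpty M → NonEmpty N → M ≡ N ⊎ (M ≻f N ⊎ N ≻f M)
    wf       : ∀ M → NonEmpty M →
               Acc (λ x y → NonEmpty x × NonEmpty y × y ≻f x) M
    extends  : ∀ c d → c ≻ d → const c ≻f const d
    subterm  : ∀ A B → NonEmpty B → B ⊆ A → B ≢ A → A ≻f B
    compat   : ∀ A₁ A₂ B → NonEmpty A₁ → NonEmpty A₂ →
               A₁ ≻f A₂ → (A₁ ∪ B) ≻f (A₂ ∪ B)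

module _ {n : ℕ} where

  -- a rule f(A) → f(B) or an equation f(A) = f(B)
  Rule : Set
  Rule = Mset n × Mset n

  _⟶⟨_⟩_ : Mset n → Rule → Mset n → Set
  M ⟶⟨ A , B ⟩ N = A ⊆ M × N ≡ ((M − A) ∪ B)

  Step1 : List Rule → Mset n → Mset n → Set
  Step1 R M N = ∃[ ρ ] (ρ ∈ R × M ⟶⟨ ρ ⟩ N)

  Reduces : List Rule → Mset n → Mset n → Set
  Reduces R = Star (Step1 R)

  Irreducible : List Rule → Mset n → Set
  Irreducible R M = ∀ N → ¬ Step1 R M N

  IsNF : List Rule → Mset n → Mset n → Set
  IsNF R M N = Reduces R M N × Irreducible R N

  Joinable : List Rule → Mset n → Mset n → Set
  Joinable R M N = ∃[ P ] (Reduces R M P × Reduces R N P)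

  cp : Rule → Rule → Rule
  cp (A₁ , A₂) (B₁ , B₂) =
    let AB = (A₁ ∪ B₁) − (A₁ ∩ B₁) in
    (((AB − A₁) ∪ A₂) , ((AB − B₁) ∪ B₂))

-- SingleACCompletion as a (nondeterministic) transition system.
-- A state is (R_f , T).

  State : Set
  State = List Rule × List Rule

  -- Interred R₀ ρ R R' E : processing the rules R yields kept rules R'
  -- and equations E moved back into T.  R₀ is the rule set R_f after
  -- adding ρ, w.r.t. which right-hand sides are normalised.
  data Interred (R₀ : List Rule) (ρ : Rule) : List Rule → List Rule → List Rule → Set where
    ir-nil  : Interred R₀ ρ [] [] []
    ir-lhs  : ∀ {l r R R' E} → (∃[ l' ] (l ⟶⟨ ρ ⟩ l')) →
              Interred R₀ ρ R R' E →
              Interred R₀ ρ ((l , r) ∷ R) R' ((l , r) ∷ E)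
    ir-rhs  : ∀ {l r r₁ r' R R' E} → ¬ (∃[ l' ] (l ⟶⟨ ρ ⟩ l')) →
              r ⟶⟨ ρ ⟩ r₁ → IsNF R₀ r₁ r' →
              Interred R₀ ρ R R' E →
              Interred R₀ ρ ((l , r) ∷ R) ((l , r') ∷ R') E
    ir-keep : ∀ {l r R R' E} → ¬ (∃[ l' ] (l ⟶⟨ ρ ⟩ l')) →
              ¬ (∃[ r₁ ] (r ⟶⟨ ρ ⟩ r₁)) →
              Interred R₀ ρ R R' E →
              Interred R₀ ρ ((l , r) ∷ R) ((l , r) ∷ R') E

  -- one iteration of steps (2)-(4), or the check of step (5)
  data CompStep (_≻f_ : Rel (Mset n) _) : State → State → Set where
    discard : ∀ {R T₁ T₂ l r l̂ r̂} →
              IsNF R l l̂ → IsNF R r r̂ → l̂ ≡ r̂ →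
              CompStep _≻f_ (R , T₁ ++ ((l , r) ∷ T₂)) (R , T₁ ++ T₂)
    orient  : ∀ {R T₁ T₂ l r l̂ r̂ ρ R' E} →
              IsNF R l l̂ → IsNF R r r̂ → l̂ ≢ r̂ →
              (ρ ≡ (l̂ , r̂) × l̂ ≻f r̂) ⊎ (ρ ≡ (r̂ , l̂) × r̂ ≻f l̂) →
              Interred (ρ ∷ R) ρ R R' E →
              CompStep _≻f_ (R , T₁ ++ ((l , r) ∷ T₂))
                            (ρ ∷ R' , T₁ ++ T₂ ++ map (cp ρ) R ++ E)
    -- (5) T is empty but some critical pair is not joinable: continue with it
    recheck : ∀ {R ρ₁ ρ₂} → ρ₁ ∈ R → ρ₂ ∈ R → ρ₁ ≢ ρ₂ →
              ¬ Joinable R (proj₁ (cp ρ₁ ρ₂)) (proj₂ (cp ρ₁ ρ₂)) →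
              CompStep _≻f_ (R , []) (R , (cp ρ₁ ρ₂ ∷ []))

  Terminates : (_≻f_ : Rel (Mset n) _) → State → Set
  Terminates _≻f_ = Acc (λ t s → CompStep _≻f_ s t)

  IsHat : (_≻_ : Rel (Fin n) _) → List (Fin n × Fin n) → (Fin n → Fin n) → Set
  IsHat _≻_ SC hat =
    ∀ c → EqClosure (λ a b → (a , b) ∈ SC) c (hat c) ×
          (∀ d → EqClosure (λ a b → (a , b) ∈ SC) c d → d ≡ hat c ⊎ d ≻ hat c)

  RC : (Fin n → Fin n) → List Rule
  RC hat = map (λ c → (const c , const (hat c)))
               (filter (λ c → ¬? (c ≟ hat c)) (allFin n))

  initial : (Fin n → Fin n) → List Rule → State
  initial hat Sf = (RC hat , Sf)

-- Whenever a rule is added, its left-hand side is a normal form of the current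
-- rules, hence lies above no existing left-hand side in the sub-multiset order;
-- interreduction only discards left-hand sides lying above the new one.  So the
-- set of reducible monomials only grows, and its complement is covered by
-- finitely many slabs (boxes in ℕⁿ with each coordinate free or fixed).  Adding a
-- left-hand side L that lies in a slab replaces that slab by finitely many slabs
-- of smaller dimension covering the points not above L.  The multiset of slab
-- dimensions therefore decreases, which is a constructive form of Dickson's
-- lemma.  Between additions, T shrinks, and a recheck of an unjoinable critical
-- pair must be followed by an addition.
module Submission where

open import Defs
open import Data.Nat using (ℕ)
open import Data.Fin using (Fin)
open import Data.List using (List)
open import Data.List.Relation.Unary.All using (All)
open import Data.Product using (_×_; proj₁; proj₂)
open import Relation.Binary using (Rel; IsStrictTotalOrder)
open import Relation.Binary.PropositionalEquality using (_≡_)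
open import Level using (0ℓ; _⊔_)

open import Function.Base using (_on_)
open import Data.Nat using (suc; _<_; _<?_; s≤s)
open import Data.Nat.Properties using (≤-refl; ≤-trans; ≮⇒≥; n<1+n)
open import Data.Nat.Induction using (<-wellFounded)
open import Data.Maybe using (Maybe; just; nothing)
open import Data.List using ([]; _∷_; _++_; map; upTo; length)
open import Data.List.Properties using (∷-injective; ++-conicalʳ)
import Data.List.Relation.Unary.All as All
import Data.List.Relation.Unary.All.Properties as All
open import Data.List.Relation.Unary.Any as Any using (Any; here; there)
import Data.List.Relation.Unary.Any.Properties as Any
open import Data.List.Membership.Propositional using (_∈_)
open import Data.List.Membership.Propositional.Properties using (∈-upTo⁺)
open import Data.Vec using (Vec; replicate) renaming ([] to []ᵥ; _∷_ to _∷ᵥ_)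
open import Data.Vec.Relation.Binary.Pointwise.Inductive as Pointwise
  using (Pointwise) renaming ([] to []ₚ; _∷_ to _∷ₚ_)
open import Data.Product using (∃-syntax; _,_; map₂)
open import Data.Sum using (_⊎_; inj₁; inj₂; map₁)
open import Data.Empty using (⊥-elim)
open import Relation.Nullary using (¬_; yes; no)
open import Relation.Binary.PropositionalEquality using (refl; sym; subst)
open import Induction.WellFounded using (Acc; acc; WellFounded)
import Relation.Binary.Construct.On as On

private
  variable
    n : ℕ

-- One Dershowitz–Manna step: an element is replaced by finitely many smaller ones.
data MultisetStep {a ℓ} {A : Set a} (_<_ : Rel A ℓ) : Rel (List A) (a ⊔ ℓ) where
  replace : ∀ {x ys xs} → All (_< x) ys → MultisetStep _<_ (ys ++ xs) (x ∷ xs)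
  skip    : ∀ {x xs ys} → MultisetStep _<_ ys xs → MultisetStep _<_ (x ∷ ys) (x ∷ xs)

module _ {a ℓ} {A : Set a} {_<_ : Rel A ℓ} where

  private
    _⋖_ = MultisetStep _<_

  multisetStep-acc-∷ : ∀ {x xs} → Acc _<_ x → Acc _⋖_ xs → Acc _⋖_ (x ∷ xs)
  multisetStep-acc-++ : ∀ {x ys xs} → Acc _<_ x → All (_< x) ys → Acc _⋖_ xs →
                        Acc _⋖_ (ys ++ xs)

  multisetStep-acc-∷ {x} {xs} acc-x (acc rs) = acc step
    where
    step : ∀ {zs} → zs ⋖ (x ∷ xs) → Acc _⋖_ zs
    step (replace ys<x) = multisetStep-acc-++ acc-x ys<x (acc rs)
    step (skip zs⋖xs)   = multisetStep-acc-∷ acc-x (rs zs⋖xs)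

  multisetStep-acc-++ acc-x All.[] acc-xs = acc-xs
  multisetStep-acc-++ (acc rs) (y<x All.∷ ys<x) acc-xs =
    multisetStep-acc-∷ (rs y<x) (multisetStep-acc-++ (acc rs) ys<x acc-xs)

  multisetStep-wellFounded : WellFounded _<_ → WellFounded _⋖_
  multisetStep-wellFounded wf []       = acc λ ()
  multisetStep-wellFounded wf (x ∷ xs) =
    multisetStep-acc-∷ (wf x) (multisetStep-wellFounded wf xs)

-- Coordinate i of a slab is either free (nothing) or fixed to a value (just c).
Slab : ℕ → Set
Slab = Vec (Maybe ℕ)

data Fits : ℕ → Maybe ℕ → Set where
  free  : ∀ {m} → Fits m nothing
  fixed : ∀ {m} → Fits m (just m)

_∈ˢ_ : Mset n → Slab n → Set
M ∈ˢ s = Pointwise Fits M s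

dim : Slab n → ℕ
dim []ᵥ             = 0
dim (nothing ∷ᵥ s) = suc (dim s)
dim (just _ ∷ᵥ s)  = dim s

fullSlab : (n : ℕ) → Slab n
fullSlab n = replicate n nothing

∈ˢ-fullSlab : (M : Mset n) → M ∈ˢ fullSlab n
∈ˢ-fullSlab []ᵥ       = []ₚ
∈ˢ-fullSlab (m ∷ᵥ M) = free ∷ₚ ∈ˢ-fullSlab M

-- On the first free coordinate, either fix it to a value below L's or keep it
-- free and split the remaining coordinates.
split : Slab n → Mset n → List (Slab n)
split []ᵥ             []ᵥ       = []
split (nothing ∷ᵥ s) (l ∷ᵥ L) =
  map (λ c → just c ∷ᵥ s) (upTo l) ++ map (nothing ∷ᵥ_) (split s L)
split (just c ∷ᵥ s)  (l ∷ᵥ L) = map (just c ∷ᵥ_) (split s L)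

split-dim : (s : Slab n) (L : Mset n) → All (λ p → dim p < dim s) (split s L)
split-dim []ᵥ             []ᵥ       = All.[]
split-dim (nothing ∷ᵥ s) (l ∷ᵥ L) =
  All.++⁺ (All.map⁺ (All.tabulate λ _ → n<1+n (dim s)))
          (All.map⁺ (All.map s≤s (split-dim s L)))
split-dim (just c ∷ᵥ s)  (l ∷ᵥ L) = All.map⁺ (split-dim s L)

split-covers : (s : Slab n) {L x : Mset n} → L ∈ˢ s → x ∈ˢ s → ¬ (L ⊆ x) →
               Any (x ∈ˢ_) (split s L)
split-covers []ᵥ {[]ᵥ} {[]ᵥ} _ _ L⊈x = ⊥-elim (L⊈x []ₚ)
split-covers (nothing ∷ᵥ s) {l ∷ᵥ L} {y ∷ᵥ x} (_ ∷ₚ L∈s) (_ ∷ₚ x∈s) L⊈x with y <? l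
... | yes y<l = Any.++⁺ˡ (Any.map⁺ (Any.map (λ { refl → fixed ∷ₚ x∈s }) (∈-upTo⁺ y<l)))
... | no  y≮l = Any.++⁺ʳ (map (λ c → just c ∷ᵥ s) (upTo l))
                  (Any.map⁺ (Any.map (free ∷ₚ_)
                    (split-covers s L∈s x∈s λ L⊆x → L⊈x (≮⇒≥ y≮l ∷ₚ L⊆x))))
split-covers (just c ∷ᵥ s) (fixed ∷ₚ L∈s) (fixed ∷ₚ x∈s) L⊈x =
  Any.map⁺ (Any.map (fixed ∷ₚ_) (split-covers s L∈s x∈s λ L⊆x → L⊈x (≤-refl ∷ₚ L⊆x)))

SlabStep : Rel (List (Slab n)) 0ℓ
SlabStep = MultisetStep (_<_ on dim)

slabStep-wellFounded : WellFounded (SlabStep {n})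
slabStep-wellFounded = multisetStep-wellFounded (On.wellFounded dim <-wellFounded)

refine : {L : Mset n} {S : List (Slab n)} → Any (L ∈ˢ_) S → List (Slab n)
refine {L = L} {s ∷ S} (here _) = split s L ++ S
refine {S = s ∷ S}     (there p) = s ∷ refine p

refine-step : {L : Mset n} {S : List (Slab n)} (p : Any (L ∈ˢ_) S) → SlabStep (refine p) S
refine-step {L = L} {s ∷ S} (here _) = replace (split-dim s L)
refine-step (there p)                = skip (refine-step p)

refine-covers : {L x : Mset n} {S : List (Slab n)} (p : Any (L ∈ˢ_) S) →
                Any (x ∈ˢ_) S → ¬ (L ⊆ x) → Any (x ∈ˢ_) (refine p)
refine-covers {S = s ∷ S} (here L∈s) (here x∈s) L⊈x = Any.++⁺ˡ (split-covers s L∈s x∈s L⊈x)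
refine-covers {L = L} {S = s ∷ S} (here _) (there q) _ = Any.++⁺ʳ (split s L) q
refine-covers (there p) (here x∈s) _   = here x∈s
refine-covers (there p) (there q) L⊈x = there (refine-covers p q L⊈x)

Reducible : List (Rule {n}) → Mset n → Set
Reducible R M = ∃[ ρ ] (ρ ∈ R × proj₁ ρ ⊆ M)

Irreducible⇒¬Reducible : {R : List (Rule {n})} {M : Mset n} → Irreducible R M → ¬ Reducible R M
Irreducible⇒¬Reducible irr (ρ , ρ∈R , lhs⊆M) = irr _ (ρ , ρ∈R , lhs⊆M , refl)

interred-lhs : ∀ {R₀ ρ R R' E} {ρ' : Rule {n}} → Interred R₀ ρ R R' E → ρ' ∈ R →
               (∃[ r ] ((proj₁ ρ' , r) ∈ R')) ⊎ (proj₁ ρ ⊆ proj₁ ρ')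
interred-lhs ir-nil ()
interred-lhs (ir-lhs (_ , ρ⊆l , _) ir) (here refl) = inj₂ ρ⊆l
interred-lhs (ir-lhs _ ir) (there ρ'∈R) = interred-lhs ir ρ'∈R
interred-lhs (ir-rhs {r' = r'} _ _ _ ir) (here refl) = inj₁ (r' , here refl)
interred-lhs (ir-rhs _ _ _ ir) (there ρ'∈R) = map₁ (map₂ there) (interred-lhs ir ρ'∈R)
interred-lhs (ir-keep {r = r} _ _ ir) (here refl) = inj₁ (r , here refl)
interred-lhs (ir-keep _ _ ir) (there ρ'∈R) = map₁ (map₂ there) (interred-lhs ir ρ'∈R)

interred-reducible : ∀ {R₀ ρ R R' E} {M : Mset n} → Interred R₀ ρ R R' E →
                     Reducible R M → Reducible (ρ ∷ R') M
interred-reducible {ρ = ρ} ir (ρ' , ρ'∈R , ρ'⊆M) with interred-lhs ir ρ'∈R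
... | inj₁ (r , ρ''∈R') = ((proj₁ ρ' , r) , there ρ''∈R' , ρ'⊆M)
... | inj₂ ρ⊆ρ'        = (ρ , here refl , Pointwise.trans ≤-trans ρ⊆ρ' ρ'⊆M)

SlabCover : List (Slab n) → List (Rule {n}) → Set
SlabCover S R = ∀ M → ¬ Reducible R M → Any (M ∈ˢ_) S

slabCover-refine : ∀ {S R ρ R₀ R' E} (p : Any (proj₁ ρ ∈ˢ_) S) →
                   Interred R₀ ρ R R' E → SlabCover {n} S R → SlabCover (refine p) (ρ ∷ R')
slabCover-refine p ir cover M ¬red =
  refine-covers p (cover M λ red → ¬red (interred-reducible ir red))
                  λ ρ⊆M → ¬red (_ , here refl , ρ⊆M)

module _ {n : ℕ} (_≻f_ : Rel (Mset n) 0ℓ) where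

  private
    Step : Rel (State {n}) 0ℓ
    Step t s = CompStep _≻f_ s t

  Oriented : Rule {n} → Mset n → Mset n → Set
  Oriented ρ l̂ r̂ = (ρ ≡ (l̂ , r̂) × l̂ ≻f r̂) ⊎ (ρ ≡ (r̂ , l̂) × r̂ ≻f l̂)

  oriented-lhs-irreducible : ∀ {R l r l̂ r̂ ρ} → IsNF R l l̂ → IsNF R r r̂ →
                             Oriented ρ l̂ r̂ → Irreducible R (proj₁ ρ)
  oriented-lhs-irreducible (_ , l̂-irr) _ (inj₁ (refl , _)) = l̂-irr
  oriented-lhs-irreducible _ (_ , r̂-irr) (inj₂ (refl , _)) = r̂-irr

  ExtensionsTerminate : List (Rule {n}) → Set
  ExtensionsTerminate R = ∀ {ρ R' E} T → Irreducible R (proj₁ ρ) →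
                          Interred (ρ ∷ R) ρ R R' E → Terminates _≻f_ (ρ ∷ R' , T)

  length-++-∷ : ∀ {A : Set} (T₁ : List A) {x T₂} → length (T₁ ++ T₂) < length (T₁ ++ x ∷ T₂)
  length-++-∷ []       = ≤-refl
  length-++-∷ (_ ∷ T₁) = s≤s (length-++-∷ T₁)

  -- Discarding is impossible here, since equal normal forms would join the pair.
  terminates-unjoinable : ∀ {R l r} → ExtensionsTerminate R → ¬ Joinable R l r →
                          Terminates _≻f_ (R , (l , r) ∷ [])
  terminates-unjoinable {R} {l} {r} ext ¬join = acc λ st → step st refl
    where
    step : ∀ {T s} → CompStep _≻f_ (R , T) s → T ≡ (l , r) ∷ [] → Terminates _≻f_ s
    step (discard {T₁ = []} (l↠l̂ , _) (r↠r̂ , _) l̂≡r̂) refl =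
      ⊥-elim (¬join (_ , l↠l̂ , subst (Reduces R r) (sym l̂≡r̂) r↠r̂))
    step (discard {T₁ = _ ∷ T₁} _ _ _) T≡ with () ← ++-conicalʳ T₁ _ (proj₂ (∷-injective T≡))
    step (orient nf-l nf-r _ or ir) _ = ext _ (oriented-lhs-irreducible nf-l nf-r or) ir
    step (recheck _ _ _ _) ()

  terminates-with : ∀ {R} → ExtensionsTerminate R → ∀ T → Terminates _≻f_ (R , T)
  terminates-with {R} ext T = go T (<-wellFounded (length T))
    where
    go : ∀ T → Acc _<_ (length T) → Terminates _≻f_ (R , T)
    go T (acc rs) = acc λ where
      (discard {T₁ = T₁} _ _ _)      → go _ (rs (length-++-∷ T₁))
      (orient nf-l nf-r _ or ir)     → ext _ (oriented-lhs-irreducible nf-l nf-r or) ir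
      (recheck _ _ _ ¬join)          → terminates-unjoinable ext ¬join

  slabCover⇒extensionsTerminate : ∀ {S R} → Acc SlabStep S → SlabCover S R →
                                  ExtensionsTerminate R
  slabCover⇒extensionsTerminate {S} (acc rs) cover {ρ} T irr ir =
    terminates-with
      (slabCover⇒extensionsTerminate (rs (refine-step p)) (slabCover-refine p ir cover)) T
    where
    p : Any (proj₁ ρ ∈ˢ_) S
    p = cover (proj₁ ρ) (Irreducible⇒¬Reducible irr)

theorem3p4 : (n : ℕ) (SC : List (Fin n × Fin n)) (Sf : List (Mset n × Mset n)) →
    All (λ e → NonEmpty (proj₁ e) × NonEmpty (proj₂ e)) Sf →
    (_≻_ : Rel (Fin n) 0ℓ) → IsStrictTotalOrder _≡_ _≻_ →
    (_≻f_ : Rel (Mset n) 0ℓ) → Admissible _≻_ _≻f_ →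
    (hat : Fin n → Fin n) → IsHat _≻_ SC hat →
    Terminates _≻f_ (initial hat Sf)
theorem3p4 n SC Sf _ _≻_ _ _≻f_ _ hat _ =
  terminates-with _≻f_ (slabCover⇒extensionsTerminate _≻f_ (slabStep-wellFounded S₀) cover₀) Sf
  where
  S₀ : List (Slab n)
  S₀ = fullSlab n ∷ []

  cover₀ : SlabCover S₀ (RC hat)
  cover₀ M _ = here (∈ˢ-fullSlab M)
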